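{- For XCCS processes, if $P \equiv_r Q$, then $P \sim Q$.
   Context: XCCS processes: $P ::= {\bf 0} \mid END \mid \alpha.P \mid P_1;P_2 \mid P_1+P_2 \mid P_1|P_2 \mid P^* \mid P\backslash L$, with running actions $\alpha ::= a\mid\overline a\mid\tau$ and an ending action $END$. Transition rules (with $\mathrm{Done}$ = successful termination): $\alpha.P\stackrel{\alpha}{\to}P$; $END\stackrel{END}{\to}\mathrm{Done}$; $P^*\stackrel{END}{\to}\mathrm{Done}$; if $P\stackrel{\alpha}{\to}P'$ then $P;Q\stackrel{\alpha}{\to}P';Q$ and $P^*\stackrel{\alpha}{\to}P';P^*$; if $P\stackrel{END}{\to}\mathrm{Done}$ and $Q\stackrel{\alpha}{\to}Q'$ then $P;Q\stackrel{\alpha}{\to}Q'$; sums and parallel composition as in CCS (interleaving plus $\tau$-communication on complementary actions); $P\backslash L$ performs the moves of $P$ outside $L\cup\overline L$; $P;Q$ and $P|Q$ do $END$ if both components do, $P+Q$ if either does, $P\backslash L$ if $P$ does. ${\bf 0}$ has no transitions. Strong bisimulation: $(P,Q)\in Z$ implies running-action transitions are matched into $Z$ both ways, and $P\stackrel{END}{\to}\mathrm{Done}$ iff $Q\stackrel{END}{\to}\mathrm{Done}$; $\sim$ is the union of strong bisimulations. $\equiv_r$ (r-congruence) is the smallest congruence (equivalence preserved by all XCCS operators), closed under alpha conversion of restricted names, with: ${\bf 0}\backslash L\equiv_r{\bf 0}$; $END\backslash L\equiv_r END$; $(\alpha.P)\backslash L\equiv_r\alpha.(P\backslash L)$ if $\alpha\notin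 L\cup\overline L$ and $\equiv_r{\bf 0}$ otherwise; $(P;Q)\backslash L\equiv_r(P\backslash L);(Q\backslash L)$; $(P+Q)\backslash L\equiv_r(P\backslash L)+(Q\backslash L)$; $P|(Q\backslash L)\equiv_r(P|Q)\backslash L$ if no name of $P$ lies in $L$; $(P^*)\backslash L\equiv_r(P\backslash L)^*$; $P\backslash L\backslash M\equiv_r P\backslash(L\cup M)$; $P\backslash L\equiv_r P$ if no name of $P$ lies in $L$. -}

module Defs where

open import Data.Nat using (ℕ; _≟_)
open import Data.List using (List; []; _∷_; _++_; map; filter)
open import Data.List.Membership.Propositional using (_∈_; _∉_)
open import Data.List.Membership.DecPropositional _≟_ using (_∈?_)
open import Data.Product using (Σ; _×_; _,_)
open import Data.Unit using (⊤)
open import Data.Bool using (if_then_else_)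
open import Relation.Nullary using (¬_; yes; no; does)
open import Relation.Nullary.Decidable using (¬?)
open import Relation.Binary.PropositionalEquality using (_≡_)

Name : Set
Name = ℕ

data Act : Set where
  inp : Name → Act
  out : Name → Act
  τ   : Act

infixr 9 _∙_
infixl 7 _⨾_
infixl 6 _⊕_
infixl 5 _∥_
infixl 10 _*
infixl 8 _∖_

data Proc : Set where
  𝟎   : Proc
  END : Proc
  _∙_ : Act → Proc → Proc
  _⨾_ : Proc → Proc → Proc
  _⊕_ : Proc → Proc → Proc
  _∥_ : Proc → Proc → Proc
  _*  : Proc → Proc
  _∖_ : Proc → List Name → Proc

data Compl : Act → Act → Set where
  io : ∀ a → Compl (inp a) (out a)
  oi : ∀ a → Compl (out a) (inp a)

Allowed : List Name → Act → Set
Allowed L (inp a) = a ∉ L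
Allowed L (out a) = a ∉ L
Allowed L τ       = ⊤

-- Ending transitions  P --END--> Done
data _⇓ : Proc → Set where
  end   : END ⇓
  star  : ∀ {P} → (P *) ⇓
  seq   : ∀ {P Q} → P ⇓ → Q ⇓ → (P ⨾ Q) ⇓
  par   : ∀ {P Q} → P ⇓ → Q ⇓ → (P ∥ Q) ⇓
  sumˡ  : ∀ {P Q} → P ⇓ → (P ⊕ Q) ⇓
  sumʳ  : ∀ {P Q} → Q ⇓ → (P ⊕ Q) ⇓
  res   : ∀ {P L} → P ⇓ → (P ∖ L) ⇓

data _—[_]→_ : Proc → Act → Proc → Set where
  pre   : ∀ {α P} → (α ∙ P) —[ α ]→ P
  seqˡ  : ∀ {P Q α P'} → P —[ α ]→ P' → (P ⨾ Q) —[ α ]→ (P' ⨾ Q)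
  seqʳ  : ∀ {P Q α Q'} → P ⇓ → Q —[ α ]→ Q' → (P ⨾ Q) —[ α ]→ Q'
  star  : ∀ {P α P'} → P —[ α ]→ P' → (P *) —[ α ]→ (P' ⨾ (P *))
  sumˡ  : ∀ {P Q α P'} → P —[ α ]→ P' → (P ⊕ Q) —[ α ]→ P'
  sumʳ  : ∀ {P Q α Q'} → Q —[ α ]→ Q' → (P ⊕ Q) —[ α ]→ Q'
  parˡ  : ∀ {P Q α P'} → P —[ α ]→ P' → (P ∥ Q) —[ α ]→ (P' ∥ Q)
  parʳ  : ∀ {P Q α Q'} → Q —[ α ]→ Q' → (P ∥ Q) —[ α ]→ (P ∥ Q')
  com   : ∀ {P Q α β P' Q'} → Compl α β → P —[ α ]→ P' → Q —[ β ]→ Q' →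
          (P ∥ Q) —[ τ ]→ (P' ∥ Q')
  res   : ∀ {P L α P'} → Allowed L α → P —[ α ]→ P' → (P ∖ L) —[ α ]→ (P' ∖ L)

record IsBisim (Z : Proc → Proc → Set) : Set where
  field
    fwd  : ∀ {P Q α P'} → Z P Q → P —[ α ]→ P' → Σ Proc (λ Q' → (Q —[ α ]→ Q') × Z P' Q')
    bwd  : ∀ {P Q α Q'} → Z P Q → Q —[ α ]→ Q' → Σ Proc (λ P' → (P —[ α ]→ P') × Z P' Q')
    endF : ∀ {P Q} → Z P Q → P ⇓ → Q ⇓
    endB : ∀ {P Q} → Z P Q → Q ⇓ → P ⇓

_∼_ : Proc → Proc → Set₁
P ∼ Q = Σ (Proc → Proc → Set) (λ Z → IsBisim Z × Z P Q)

actNames : Act → List Name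
actNames (inp a) = a ∷ []
actNames (out a) = a ∷ []
actNames τ       = []

fn : Proc → List Name
fn 𝟎       = []
fn END     = []
fn (α ∙ P) = actNames α ++ fn P
fn (P ⨾ Q) = fn P ++ fn Q
fn (P ⊕ Q) = fn P ++ fn Q
fn (P ∥ Q) = fn P ++ fn Q
fn (P *)   = fn P
fn (P ∖ L) = filter (λ x → ¬? (x ∈? L)) (fn P)

names : Proc → List Name
names 𝟎       = []
names END     = []
names (α ∙ P) = actNames α ++ names P
names (P ⨾ Q) = names P ++ names Q
names (P ⊕ Q) = names P ++ names Q
names (P ∥ Q) = names P ++ names Q
names (P *)   = names P
names (P ∖ L) = L ++ names P

Disjoint : Proc → List Name → Set
Disjoint P L = ∀ {x} → x ∈ fn P → x ∉ L

renN : Name → Name → Name → Name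
renN b a x = if does (x ≟ a) then b else x

renAct : Name → Name → Act → Act
renAct b a (inp x) = inp (renN b a x)
renAct b a (out x) = out (renN b a x)
renAct b a τ       = τ

-- substitution P{b/a} of free occurrences of a by b
-- (used only with b fresh for P, so no capture can occur)
subst : Name → Name → Proc → Proc
subst b a 𝟎       = 𝟎
subst b a END     = END
subst b a (α ∙ P) = renAct b a α ∙ subst b a P
subst b a (P ⨾ Q) = subst b a P ⨾ subst b a Q
subst b a (P ⊕ Q) = subst b a P ⊕ subst b a Q
subst b a (P ∥ Q) = subst b a P ∥ subst b a Q
subst b a (P *)   = subst b a P *
subst b a (P ∖ L) with a ∈? L
... | yes _ = P ∖ L
... | no  _ = subst b a P ∖ L

infix 4 _≡r_
data _≡r_ : Proc → Proc → Set where
  refl  : ∀ {P} → P ≡r P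
  sym   : ∀ {P Q} → P ≡r Q → Q ≡r P
  trans : ∀ {P Q R} → P ≡r Q → Q ≡r R → P ≡r R
  c-pre : ∀ {α P Q} → P ≡r Q → (α ∙ P) ≡r (α ∙ Q)
  c-seq : ∀ {P P' Q Q'} → P ≡r P' → Q ≡r Q' → (P ⨾ Q) ≡r (P' ⨾ Q')
  c-sum : ∀ {P P' Q Q'} → P ≡r P' → Q ≡r Q' → (P ⊕ Q) ≡r (P' ⊕ Q')
  c-par : ∀ {P P' Q Q'} → P ≡r P' → Q ≡r Q' → (P ∥ Q) ≡r (P' ∥ Q')
  c-star : ∀ {P Q} → P ≡r Q → (P *) ≡r (Q *)
  c-res : ∀ {P Q L} → P ≡r Q → (P ∖ L) ≡r (Q ∖ L)
  alpha : ∀ {P L a b} → a ∈ L → b ∉ L → b ∉ names P →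
          (P ∖ L) ≡r (subst b a P ∖ map (renN b a) L)
  r-nil   : ∀ {L} → (𝟎 ∖ L) ≡r 𝟎
  r-end   : ∀ {L} → (END ∖ L) ≡r END
  r-pre   : ∀ {α P L} → Allowed L α → ((α ∙ P) ∖ L) ≡r (α ∙ (P ∖ L))
  r-pre0  : ∀ {α P L} → ¬ Allowed L α → ((α ∙ P) ∖ L) ≡r 𝟎
  r-seq   : ∀ {P Q L} → ((P ⨾ Q) ∖ L) ≡r ((P ∖ L) ⨾ (Q ∖ L))
  r-sum   : ∀ {P Q L} → ((P ⊕ Q) ∖ L) ≡r ((P ∖ L) ⊕ (Q ∖ L))
  r-par   : ∀ {P Q L} → Disjoint P L → (P ∥ (Q ∖ L)) ≡r ((P ∥ Q) ∖ L)
  r-star  : ∀ {P L} → ((P *) ∖ L) ≡r ((P ∖ L) *)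
  r-resres : ∀ {P L M} → ((P ∖ L) ∖ M) ≡r (P ∖ (L ++ M))
  r-drop  : ∀ {P L} → Disjoint P L → (P ∖ L) ≡r P

module Submission where

open import Defs
open import Data.Nat using (_≟_)
open import Data.List using (List; _++_; map)
open import Data.List.Membership.Propositional using (_∈_; _∉_)
open import Data.List.Membership.Propositional.Properties
  using (∈-++⁺ˡ; ∈-++⁺ʳ; ∈-++⁻; ∈-filter⁺; ∈-filter⁻; ∈-map⁺; ∈-map⁻)
open import Data.List.Membership.DecPropositional _≟_ using (_∈?_)
open import Data.List.Relation.Unary.Any using (here)
open import Data.Product using (Σ; _×_; _,_)
open import Data.Sum using (inj₁; inj₂; [_,_]′)
open import Data.Unit using (tt)
open import Data.Bool using (if_then_else_)
open import Data.Empty using (⊥-elim)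
open import Relation.Nullary using (¬_; yes; no)
open import Relation.Binary.Definitions using (Reflexive; Symmetric; Transitive)
open import Relation.Nullary.Decidable using (¬?; dec-true; dec-false)
import Relation.Binary.PropositionalEquality as ≡
open ≡ using (_≡_; _≢_; refl; cong)

-- ≡r is itself a strong bisimulation: for every axiom, alpha conversion and
-- congruence rule, each move of one side is matched by the same move of the other
-- with ≡r-related derivatives, and symmetry and transitivity preserve this.
-- The side conditions are what make it work: names absent from a process are
-- absent from its labels and derivatives, so a fresh renaming {b/a} maps the
-- transitions of P bijectively onto those of P{b/a}.

Compl-io⇒≡ : ∀ {u v} → Compl (inp u) (out v) → u ≡ v
Compl-io⇒≡ (io _) = refl

Compl-oi⇒≡ : ∀ {u v} → Compl (out u) (inp v) → u ≡ v
Compl-oi⇒≡ (oi _) = refl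

Allowed⇒∉ : ∀ {L α x} → Allowed L α → x ∈ actNames α → x ∉ L
Allowed⇒∉ {α = inp _} al (here refl) = al
Allowed⇒∉ {α = out _} al (here refl) = al

∉⇒Allowed : ∀ {L α} → (∀ {x} → x ∈ actNames α → x ∉ L) → Allowed L α
∉⇒Allowed {α = inp _} h = h (here refl)
∉⇒Allowed {α = out _} h = h (here refl)
∉⇒Allowed {α = τ}     h = tt

Allowed-compl : ∀ {L α β} → Compl α β → Allowed L α → Allowed L β
Allowed-compl (io _) al = al
Allowed-compl (oi _) al = al

Allowed-++ : ∀ L {M α} → Allowed L α → Allowed M α → Allowed (L ++ M) α
Allowed-++ L al am =
  ∉⇒Allowed (λ x∈α x∈L++M → [ Allowed⇒∉ al x∈α , Allowed⇒∉ am x∈α ]′ (∈-++⁻ L x∈L++M))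

Allowed-++⁻ˡ : ∀ L {M α} → Allowed (L ++ M) α → Allowed L α
Allowed-++⁻ˡ L al = ∉⇒Allowed (λ x∈α x∈L → Allowed⇒∉ al x∈α (∈-++⁺ˡ x∈L))

Allowed-++⁻ʳ : ∀ L {M α} → Allowed (L ++ M) α → Allowed M α
Allowed-++⁻ʳ L al = ∉⇒Allowed (λ x∈α x∈M → Allowed⇒∉ al x∈α (∈-++⁺ʳ L x∈M))

fn-label : ∀ {P α P'} → P —[ α ]→ P' → ∀ {x} → x ∈ actNames α → x ∈ fn P
fn-label pre               x∈α = ∈-++⁺ˡ x∈α
fn-label (seqˡ t)          x∈α = ∈-++⁺ˡ (fn-label t x∈α)
fn-label (seqʳ {P} _ t)    x∈α = ∈-++⁺ʳ (fn P) (fn-label t x∈α)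
fn-label (star t)          x∈α = fn-label t x∈α
fn-label (sumˡ t)          x∈α = ∈-++⁺ˡ (fn-label t x∈α)
fn-label (sumʳ {P} t)      x∈α = ∈-++⁺ʳ (fn P) (fn-label t x∈α)
fn-label (parˡ t)          x∈α = ∈-++⁺ˡ (fn-label t x∈α)
fn-label (parʳ {P} t)      x∈α = ∈-++⁺ʳ (fn P) (fn-label t x∈α)
fn-label (res {L = L} al t) x∈α =
  ∈-filter⁺ (λ y → ¬? (y ∈? L)) (fn-label t x∈α) (Allowed⇒∉ al x∈α)

fn-derivative : ∀ {P α P'} → P —[ α ]→ P' → ∀ {x} → x ∈ fn P' → x ∈ fn P
fn-derivative (pre {α}) x∈P' = ∈-++⁺ʳ (actNames α) x∈P'
fn-derivative (seqˡ {P' = P'} t) x∈P' with ∈-++⁻ (fn P') x∈P'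
... | inj₁ x∈ = ∈-++⁺ˡ (fn-derivative t x∈)
... | inj₂ x∈ = ∈-++⁺ʳ _ x∈
fn-derivative (seqʳ {P} _ t) x∈Q' = ∈-++⁺ʳ (fn P) (fn-derivative t x∈Q')
fn-derivative (star {P' = P'} t) x∈ with ∈-++⁻ (fn P') x∈
... | inj₁ x∈P' = fn-derivative t x∈P'
... | inj₂ x∈P* = x∈P*
fn-derivative (sumˡ t) x∈P' = ∈-++⁺ˡ (fn-derivative t x∈P')
fn-derivative (sumʳ {P} t) x∈Q' = ∈-++⁺ʳ (fn P) (fn-derivative t x∈Q')
fn-derivative (parˡ {P' = P'} t) x∈ with ∈-++⁻ (fn P') x∈
... | inj₁ x∈P' = ∈-++⁺ˡ (fn-derivative t x∈P')
... | inj₂ x∈Q  = ∈-++⁺ʳ _ x∈Q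
fn-derivative (parʳ {P} t) x∈ with ∈-++⁻ (fn P) x∈
... | inj₁ x∈P  = ∈-++⁺ˡ x∈P
... | inj₂ x∈Q' = ∈-++⁺ʳ (fn P) (fn-derivative t x∈Q')
fn-derivative (com {P' = P'} _ t u) x∈ with ∈-++⁻ (fn P') x∈
... | inj₁ x∈P' = ∈-++⁺ˡ (fn-derivative t x∈P')
... | inj₂ x∈Q' = ∈-++⁺ʳ _ (fn-derivative u x∈Q')
fn-derivative (res {L = L} _ t) x∈ with ∈-filter⁻ (λ y → ¬? (y ∈? L)) x∈
... | x∈P' , x∉L = ∈-filter⁺ (λ y → ¬? (y ∈? L)) (fn-derivative t x∈P') x∉L

Disjoint-label : ∀ {P L α P'} → Disjoint P L → P —[ α ]→ P' → Allowed L α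
Disjoint-label dj t = ∉⇒Allowed (λ x∈α → dj (fn-label t x∈α))

Disjoint-derivative : ∀ {P L α P'} → Disjoint P L → P —[ α ]→ P' → Disjoint P' L
Disjoint-derivative dj t x∈P' = dj (fn-derivative t x∈P')

names-label : ∀ {P α P'} → P —[ α ]→ P' → ∀ {x} → x ∈ actNames α → x ∈ names P
names-label pre                x∈α = ∈-++⁺ˡ x∈α
names-label (seqˡ t)           x∈α = ∈-++⁺ˡ (names-label t x∈α)
names-label (seqʳ {P} _ t)     x∈α = ∈-++⁺ʳ (names P) (names-label t x∈α)
names-label (star t)           x∈α = names-label t x∈α
names-label (sumˡ t)           x∈α = ∈-++⁺ˡ (names-label t x∈α)
names-label (sumʳ {P} t)       x∈α = ∈-++⁺ʳ (names P) (names-label t x∈α)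
names-label (parˡ t)           x∈α = ∈-++⁺ˡ (names-label t x∈α)
names-label (parʳ {P} t)       x∈α = ∈-++⁺ʳ (names P) (names-label t x∈α)
names-label (res {L = L} _ t)  x∈α = ∈-++⁺ʳ L (names-label t x∈α)

names-derivative : ∀ {P α P'} → P —[ α ]→ P' → ∀ {x} → x ∈ names P' → x ∈ names P
names-derivative (pre {α}) x∈P' = ∈-++⁺ʳ (actNames α) x∈P'
names-derivative (seqˡ {P' = P'} t) x∈ with ∈-++⁻ (names P') x∈
... | inj₁ x∈P' = ∈-++⁺ˡ (names-derivative t x∈P')
... | inj₂ x∈Q  = ∈-++⁺ʳ _ x∈Q
names-derivative (seqʳ {P} _ t) x∈Q' = ∈-++⁺ʳ (names P) (names-derivative t x∈Q')
names-derivative (star {P' = P'} t) x∈ with ∈-++⁻ (names P') x∈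
... | inj₁ x∈P' = names-derivative t x∈P'
... | inj₂ x∈P* = x∈P*
names-derivative (sumˡ t) x∈P' = ∈-++⁺ˡ (names-derivative t x∈P')
names-derivative (sumʳ {P} t) x∈Q' = ∈-++⁺ʳ (names P) (names-derivative t x∈Q')
names-derivative (parˡ {P' = P'} t) x∈ with ∈-++⁻ (names P') x∈
... | inj₁ x∈P' = ∈-++⁺ˡ (names-derivative t x∈P')
... | inj₂ x∈Q  = ∈-++⁺ʳ _ x∈Q
names-derivative (parʳ {P} t) x∈ with ∈-++⁻ (names P) x∈
... | inj₁ x∈P  = ∈-++⁺ˡ x∈P
... | inj₂ x∈Q' = ∈-++⁺ʳ (names P) (names-derivative t x∈Q')
names-derivative (com {P' = P'} _ t u) x∈ with ∈-++⁻ (names P') x∈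
... | inj₁ x∈P' = ∈-++⁺ˡ (names-derivative t x∈P')
... | inj₂ x∈Q' = ∈-++⁺ʳ _ (names-derivative u x∈Q')
names-derivative (res {L = L} _ t) x∈ with ∈-++⁻ L x∈
... | inj₁ x∈L  = ∈-++⁺ˡ x∈L
... | inj₂ x∈P' = ∈-++⁺ʳ L (names-derivative t x∈P')

∉-++ˡ : ∀ {x} (xs : List Name) {ys} → x ∉ xs ++ ys → x ∉ xs
∉-++ˡ _ x∉ x∈ = x∉ (∈-++⁺ˡ x∈)

∉-++ʳ : ∀ {x} (xs : List Name) {ys} → x ∉ xs ++ ys → x ∉ ys
∉-++ʳ xs x∉ x∈ = x∉ (∈-++⁺ʳ xs x∈)

module Renaming (b a : Name) where

  renN-≢ : ∀ {x} → x ≢ a → renN b a x ≡ x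
  renN-≢ {x} x≢a = cong (if_then b else x) (dec-false (x ≟ a) x≢a)

  renN-a : renN b a a ≡ b
  renN-a = cong (if_then b else a) (dec-true (a ≟ a) refl)

  renN-injective : ∀ {x y} → x ≢ b → y ≢ b → renN b a x ≡ renN b a y → x ≡ y
  renN-injective {x} {y} x≢b y≢b eq with x ≟ a | y ≟ a
  ... | yes refl | yes refl = refl
  ... | yes refl | no y≢a   = ⊥-elim (y≢b (≡.trans (≡.sym (renN-≢ y≢a)) (≡.trans (≡.sym eq) renN-a)))
  ... | no x≢a   | yes refl = ⊥-elim (x≢b (≡.trans (≡.sym (renN-≢ x≢a)) (≡.trans eq renN-a)))
  ... | no x≢a   | no y≢a   = ≡.trans (≡.sym (renN-≢ x≢a)) (≡.trans eq (renN-≢ y≢a))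

  renN-∉ : ∀ {x L} → b ∉ L → x ∉ L → renN b a x ∉ L
  renN-∉ {x} {L} b∉L x∉L with x ≟ a
  ... | yes refl = ≡.subst (_∉ L) (≡.sym renN-a) b∉L
  ... | no x≢a   = ≡.subst (_∉ L) (≡.sym (renN-≢ x≢a)) x∉L

  renN-∉⁻ : ∀ {x L} → a ∉ L → renN b a x ∉ L → x ∉ L
  renN-∉⁻ {x} {L} a∉L h with x ≟ a
  ... | yes refl = a∉L
  ... | no x≢a   = ≡.subst (_∉ L) (renN-≢ x≢a) h

  ∉-map-renN : ∀ {x L} → x ≢ b → x ∉ L → x ∉ map (renN b a) L
  ∉-map-renN {x} {L} x≢b x∉L x∈ with ∈-map⁻ (renN b a) x∈
  ... | y , y∈L , x≡y' with y ≟ a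
  ...   | yes refl = x≢b (≡.trans x≡y' renN-a)
  ...   | no y≢a   = x∉L (≡.subst (_∈ L) (≡.sym (≡.trans x≡y' (renN-≢ y≢a))) y∈L)

  renAct-fixed : ∀ {L α} → a ∈ L → Allowed L α → renAct b a α ≡ α
  renAct-fixed {α = inp x} a∈L al = cong inp (renN-≢ λ { refl → al a∈L })
  renAct-fixed {α = out x} a∈L al = cong out (renN-≢ λ { refl → al a∈L })
  renAct-fixed {α = τ}     _   _  = refl

  Allowed-renAct : ∀ {L α} → b ∉ L → Allowed L α → Allowed L (renAct b a α)
  Allowed-renAct {α = inp _} b∉L al = renN-∉ b∉L al
  Allowed-renAct {α = out _} b∉L al = renN-∉ b∉L al
  Allowed-renAct {α = τ}     _   _  = tt

  Allowed-renAct⁻ : ∀ {L α} → a ∉ L → Allowed L (renAct b a α) → Allowed L α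
  Allowed-renAct⁻ {α = inp _} a∉L al = renN-∉⁻ a∉L al
  Allowed-renAct⁻ {α = out _} a∉L al = renN-∉⁻ a∉L al
  Allowed-renAct⁻ {α = τ}     _   _  = tt

  Allowed-map-renN : ∀ {L α} → b ∉ actNames α → Allowed L α → Allowed (map (renN b a) L) α
  Allowed-map-renN {α = inp x} b∉α al = ∉-map-renN (λ { refl → b∉α (here refl) }) al
  Allowed-map-renN {α = out x} b∉α al = ∉-map-renN (λ { refl → b∉α (here refl) }) al
  Allowed-map-renN {α = τ}     _   _  = tt

  Allowed-map-renN⁻ : ∀ {L α} → Allowed (map (renN b a) L) (renAct b a α) → Allowed L α
  Allowed-map-renN⁻ {α = inp _} al x∈L = al (∈-map⁺ (renN b a) x∈L)
  Allowed-map-renN⁻ {α = out _} al x∈L = al (∈-map⁺ (renN b a) x∈L)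
  Allowed-map-renN⁻ {α = τ}     _      = tt

  Compl-renAct : ∀ {α β} → Compl α β → Compl (renAct b a α) (renAct b a β)
  Compl-renAct (io x) = io (renN b a x)
  Compl-renAct (oi x) = oi (renN b a x)

  Compl-renAct⁻ : ∀ {α β} → b ∉ actNames α → b ∉ actNames β →
                  Compl (renAct b a α) (renAct b a β) → Compl α β
  Compl-renAct⁻ {inp x} {out y} b∉α b∉β c
    with renN-injective {x} {y} (λ { refl → b∉α (here refl) }) (λ { refl → b∉β (here refl) }) (Compl-io⇒≡ c)
  ... | refl = io x
  Compl-renAct⁻ {out x} {inp y} b∉α b∉β c
    with renN-injective {x} {y} (λ { refl → b∉α (here refl) }) (λ { refl → b∉β (here refl) }) (Compl-oi⇒≡ c)
  ... | refl = oi x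
  Compl-renAct⁻ {inp _} {inp _} _ _ ()
  Compl-renAct⁻ {inp _} {τ}     _ _ ()
  Compl-renAct⁻ {out _} {out _} _ _ ()
  Compl-renAct⁻ {out _} {τ}     _ _ ()
  Compl-renAct⁻ {τ}             _ _ ()

  subst-∖-bound : ∀ {P L} → a ∈ L → subst b a (P ∖ L) ≡ P ∖ L
  subst-∖-bound {L = L} a∈L with a ∈? L
  ... | yes _   = refl
  ... | no a∉L = ⊥-elim (a∉L a∈L)

  subst-∖-free : ∀ {P L} → a ∉ L → subst b a (P ∖ L) ≡ subst b a P ∖ L
  subst-∖-free {L = L} a∉L with a ∈? L
  ... | yes a∈L = ⊥-elim (a∉L a∈L)
  ... | no _    = refl

  subst-⇓ : ∀ {P} → P ⇓ → subst b a P ⇓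
  subst-⇓ end        = end
  subst-⇓ star       = star
  subst-⇓ (seq p q)  = seq (subst-⇓ p) (subst-⇓ q)
  subst-⇓ (par p q)  = par (subst-⇓ p) (subst-⇓ q)
  subst-⇓ (sumˡ p)   = sumˡ (subst-⇓ p)
  subst-⇓ (sumʳ q)   = sumʳ (subst-⇓ q)
  subst-⇓ (res {L = L} p) with a ∈? L
  ... | yes _ = res p
  ... | no _  = res (subst-⇓ p)

  subst-⇓⁻ : ∀ P → subst b a P ⇓ → P ⇓
  subst-⇓⁻ END     _          = end
  subst-⇓⁻ (P ⨾ Q) (seq p q)  = seq (subst-⇓⁻ P p) (subst-⇓⁻ Q q)
  subst-⇓⁻ (P ⊕ Q) (sumˡ p)   = sumˡ (subst-⇓⁻ P p)
  subst-⇓⁻ (P ⊕ Q) (sumʳ q)   = sumʳ (subst-⇓⁻ Q q)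
  subst-⇓⁻ (P ∥ Q) (par p q)  = par (subst-⇓⁻ P p) (subst-⇓⁻ Q q)
  subst-⇓⁻ (P *)   _          = star
  subst-⇓⁻ (P ∖ L) p with a ∈? L
  subst-⇓⁻ (P ∖ L) p       | yes _ = p
  subst-⇓⁻ (P ∖ L) (res p) | no _  = res (subst-⇓⁻ P p)

  subst-step : ∀ {P α P'} → b ∉ names P → P —[ α ]→ P' →
               subst b a P —[ renAct b a α ]→ subst b a P'
  subst-step _ pre = pre
  subst-step {P ⨾ _} b∉ (seqˡ t)     = seqˡ (subst-step (∉-++ˡ (names P) b∉) t)
  subst-step {P ⨾ _} b∉ (seqʳ p t)   = seqʳ (subst-⇓ p) (subst-step (∉-++ʳ (names P) b∉) t)
  subst-step b∉ (star t)             = star (subst-step b∉ t)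
  subst-step {P ⊕ _} b∉ (sumˡ t)     = sumˡ (subst-step (∉-++ˡ (names P) b∉) t)
  subst-step {P ⊕ _} b∉ (sumʳ t)     = sumʳ (subst-step (∉-++ʳ (names P) b∉) t)
  subst-step {P ∥ _} b∉ (parˡ t)     = parˡ (subst-step (∉-++ˡ (names P) b∉) t)
  subst-step {P ∥ _} b∉ (parʳ t)     = parʳ (subst-step (∉-++ʳ (names P) b∉) t)
  subst-step {P ∥ _} b∉ (com c t u)  =
    com (Compl-renAct c) (subst-step (∉-++ˡ (names P) b∉) t) (subst-step (∉-++ʳ (names P) b∉) u)
  subst-step {_ ∖ L} b∉ (res al t) with a ∈? L
  ... | yes a∈L rewrite renAct-fixed a∈L al = res al t
  ... | no _    = res (Allowed-renAct (∉-++ˡ L b∉) al) (subst-step (∉-++ʳ L b∉) t)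

  data SubstStep (P : Proc) : Act → Proc → Set where
    image : ∀ {α P'} → P —[ α ]→ P' → SubstStep P (renAct b a α) (subst b a P')

  subst-step⁻ : ∀ P {β R} → b ∉ names P → subst b a P —[ β ]→ R → SubstStep P β R
  subst-step⁻ (α ∙ P) _ pre = image pre
  subst-step⁻ (P ⨾ Q) b∉ (seqˡ t) with subst-step⁻ P (∉-++ˡ (names P) b∉) t
  ... | image tP = image (seqˡ tP)
  subst-step⁻ (P ⨾ Q) b∉ (seqʳ p t) with subst-step⁻ Q (∉-++ʳ (names P) b∉) t
  ... | image tQ = image (seqʳ (subst-⇓⁻ P p) tQ)
  subst-step⁻ (P ⊕ Q) b∉ (sumˡ t) with subst-step⁻ P (∉-++ˡ (names P) b∉) t
  ... | image tP = image (sumˡ tP)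
  subst-step⁻ (P ⊕ Q) b∉ (sumʳ t) with subst-step⁻ Q (∉-++ʳ (names P) b∉) t
  ... | image tQ = image (sumʳ tQ)
  subst-step⁻ (P ∥ Q) b∉ (parˡ t) with subst-step⁻ P (∉-++ˡ (names P) b∉) t
  ... | image tP = image (parˡ tP)
  subst-step⁻ (P ∥ Q) b∉ (parʳ t) with subst-step⁻ Q (∉-++ʳ (names P) b∉) t
  ... | image tQ = image (parʳ tQ)
  subst-step⁻ (P ∥ Q) b∉ (com c t u)
    with subst-step⁻ P (∉-++ˡ (names P) b∉) t | subst-step⁻ Q (∉-++ʳ (names P) b∉) u
  ... | image tP | image tQ =
    image (com (Compl-renAct⁻ (λ b∈ → ∉-++ˡ (names P) b∉ (names-label tP b∈))
                              (λ b∈ → ∉-++ʳ (names P) b∉ (names-label tQ b∈)) c) tP tQ)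
  subst-step⁻ (P *) b∉ (star t) with subst-step⁻ P b∉ t
  ... | image tP = image (star tP)
  subst-step⁻ (P ∖ L) b∉ t with a ∈? L
  subst-step⁻ (P ∖ L) b∉ (res al t) | yes a∈L =
    ≡.subst₂ (SubstStep (P ∖ L)) (renAct-fixed a∈L al) (subst-∖-bound a∈L) (image (res al t))
  subst-step⁻ (P ∖ L) b∉ (res al t) | no a∉L with subst-step⁻ P (∉-++ʳ L b∉) t
  ... | image tP =
    ≡.subst (SubstStep (P ∖ L) _) (subst-∖-free a∉L) (image (res (Allowed-renAct⁻ a∉L al) tP))

record Progress (R : Proc → Proc → Set) (P Q : Proc) : Set where
  field
    fwd  : ∀ {α P'} → P —[ α ]→ P' → Σ Proc λ Q' → (Q —[ α ]→ Q') × R P' Q'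
    bwd  : ∀ {α Q'} → Q —[ α ]→ Q' → Σ Proc λ P' → (P —[ α ]→ P') × R P' Q'
    endF : P ⇓ → Q ⇓
    endB : Q ⇓ → P ⇓
open Progress

module _ {R : Proc → Proc → Set} where

  Progress-refl : Reflexive R → ∀ {P} → Progress R P P
  fwd  (Progress-refl r) t = _ , t , r
  bwd  (Progress-refl r) t = _ , t , r
  endF (Progress-refl r) p = p
  endB (Progress-refl r) p = p

  Progress-sym : Symmetric R → ∀ {P Q} → Progress R P Q → Progress R Q P
  fwd  (Progress-sym s pq) t with bwd pq t
  ... | P' , t' , r = P' , t' , s r
  bwd  (Progress-sym s pq) t with fwd pq t
  ... | Q' , t' , r = Q' , t' , s r
  endF (Progress-sym s pq) = endB pq
  endB (Progress-sym s pq) = endF pq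

  Progress-trans : Transitive R → ∀ {P Q S} → Progress R P Q → Progress R Q S → Progress R P S
  fwd  (Progress-trans tr pq qs) t with fwd pq t
  ... | Q' , tQ , r₁ with fwd qs tQ
  ...   | S' , tS , r₂ = S' , tS , tr r₁ r₂
  bwd  (Progress-trans tr pq qs) t with bwd qs t
  ... | Q' , tQ , r₂ with bwd pq tQ
  ...   | P' , tP , r₁ = P' , tP , tr r₁ r₂
  endF (Progress-trans tr pq qs) p = endF qs (endF pq p)
  endB (Progress-trans tr pq qs) s = endB pq (endB qs s)

  Progress⇒IsBisim : (∀ {P Q} → R P Q → Progress R P Q) → IsBisim R
  Progress⇒IsBisim progress = record
    { fwd  = λ r → fwd (progress r)
    ; bwd  = λ r → bwd (progress r)
    ; endF = λ r → endF (progress r)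
    ; endB = λ r → endB (progress r)
    }

Progress-∙ : ∀ {α P Q} → P ≡r Q → Progress _≡r_ (α ∙ P) (α ∙ Q)
fwd  (Progress-∙ e) pre = _ , pre , e
bwd  (Progress-∙ e) pre = _ , pre , e
endF (Progress-∙ e) ()
endB (Progress-∙ e) ()

Progress-⨾ : ∀ {P P' Q Q'} → Q ≡r Q' →
             Progress _≡r_ P P' → Progress _≡r_ Q Q' → Progress _≡r_ (P ⨾ Q) (P' ⨾ Q')
fwd  (Progress-⨾ e pp qq) (seqˡ t) with fwd pp t
... | _ , t' , r = _ , seqˡ t' , c-seq r e
fwd  (Progress-⨾ e pp qq) (seqʳ p t) with fwd qq t
... | _ , t' , r = _ , seqʳ (endF pp p) t' , r
bwd  (Progress-⨾ e pp qq) (seqˡ t) with bwd pp t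
... | _ , t' , r = _ , seqˡ t' , c-seq r e
bwd  (Progress-⨾ e pp qq) (seqʳ p t) with bwd qq t
... | _ , t' , r = _ , seqʳ (endB pp p) t' , r
endF (Progress-⨾ e pp qq) (seq p q) = seq (endF pp p) (endF qq q)
endB (Progress-⨾ e pp qq) (seq p q) = seq (endB pp p) (endB qq q)

Progress-⊕ : ∀ {P P' Q Q'} →
             Progress _≡r_ P P' → Progress _≡r_ Q Q' → Progress _≡r_ (P ⊕ Q) (P' ⊕ Q')
fwd  (Progress-⊕ pp qq) (sumˡ t) with fwd pp t
... | _ , t' , r = _ , sumˡ t' , r
fwd  (Progress-⊕ pp qq) (sumʳ t) with fwd qq t
... | _ , t' , r = _ , sumʳ t' , r
bwd  (Progress-⊕ pp qq) (sumˡ t) with bwd pp t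
... | _ , t' , r = _ , sumˡ t' , r
bwd  (Progress-⊕ pp qq) (sumʳ t) with bwd qq t
... | _ , t' , r = _ , sumʳ t' , r
endF (Progress-⊕ pp qq) (sumˡ p) = sumˡ (endF pp p)
endF (Progress-⊕ pp qq) (sumʳ q) = sumʳ (endF qq q)
endB (Progress-⊕ pp qq) (sumˡ p) = sumˡ (endB pp p)
endB (Progress-⊕ pp qq) (sumʳ q) = sumʳ (endB qq q)

Progress-∥ : ∀ {P P' Q Q'} → P ≡r P' → Q ≡r Q' →
             Progress _≡r_ P P' → Progress _≡r_ Q Q' → Progress _≡r_ (P ∥ Q) (P' ∥ Q')
fwd  (Progress-∥ e f pp qq) (parˡ t) with fwd pp t
... | _ , t' , r = _ , parˡ t' , c-par r f
fwd  (Progress-∥ e f pp qq) (parʳ t) with fwd qq t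
... | _ , t' , r = _ , parʳ t' , c-par e r
fwd  (Progress-∥ e f pp qq) (com c t u) with fwd pp t | fwd qq u
... | _ , t' , r | _ , u' , r' = _ , com c t' u' , c-par r r'
bwd  (Progress-∥ e f pp qq) (parˡ t) with bwd pp t
... | _ , t' , r = _ , parˡ t' , c-par r f
bwd  (Progress-∥ e f pp qq) (parʳ t) with bwd qq t
... | _ , t' , r = _ , parʳ t' , c-par e r
bwd  (Progress-∥ e f pp qq) (com c t u) with bwd pp t | bwd qq u
... | _ , t' , r | _ , u' , r' = _ , com c t' u' , c-par r r'
endF (Progress-∥ e f pp qq) (par p q) = par (endF pp p) (endF qq q)
endB (Progress-∥ e f pp qq) (par p q) = par (endB pp p) (endB qq q)

Progress-* : ∀ {P Q} → P ≡r Q → Progress _≡r_ P Q → Progress _≡r_ (P *) (Q *)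
fwd  (Progress-* e pq) (star t) with fwd pq t
... | _ , t' , r = _ , star t' , c-seq r (c-star e)
bwd  (Progress-* e pq) (star t) with bwd pq t
... | _ , t' , r = _ , star t' , c-seq r (c-star e)
endF (Progress-* e pq) _ = star
endB (Progress-* e pq) _ = star

Progress-∖ : ∀ {P Q L} → Progress _≡r_ P Q → Progress _≡r_ (P ∖ L) (Q ∖ L)
fwd  (Progress-∖ pq) (res al t) with fwd pq t
... | _ , t' , r = _ , res al t' , c-res r
bwd  (Progress-∖ pq) (res al t) with bwd pq t
... | _ , t' , r = _ , res al t' , c-res r
endF (Progress-∖ pq) (res p) = res (endF pq p)
endB (Progress-∖ pq) (res q) = res (endB pq q)

-- Labels allowed under the restriction L ∋ a never mention a, so {b/a} fixes them.
Progress-alpha : ∀ {P L a b} → a ∈ L → b ∉ L → b ∉ names P →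
                 Progress _≡r_ (P ∖ L) (subst b a P ∖ map (renN b a) L)
fwd (Progress-alpha {P} {L} {a} {b} a∈L b∉L b∉P) (res {α = α} {P' = P'} al t) =
  _ , res (Allowed-map-renN (λ b∈α → b∉P (names-label t b∈α)) al) t' ,
  alpha a∈L b∉L (λ b∈P' → b∉P (names-derivative t b∈P'))
  where
    open Renaming b a
    t' : subst b a P —[ α ]→ subst b a P'
    t' = ≡.subst (λ γ → subst b a P —[ γ ]→ subst b a P') (renAct-fixed a∈L al) (subst-step b∉P t)
bwd (Progress-alpha {P} {L} {a} {b} a∈L b∉L b∉P) (res al t) with Renaming.subst-step⁻ b a P b∉P t
... | Renaming.image {α} {P'} tP =
  P' ∖ L ,
  ≡.subst (λ γ → (P ∖ L) —[ γ ]→ (P' ∖ L)) (≡.sym (renAct-fixed a∈L α-allowed)) (res α-allowed tP) ,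
  alpha a∈L b∉L (λ b∈P' → b∉P (names-derivative tP b∈P'))
  where
    open Renaming b a
    α-allowed : Allowed L α
    α-allowed = Allowed-map-renN⁻ al
endF (Progress-alpha {a = a} {b} _ _ _) (res p) = res (Renaming.subst-⇓ b a p)
endB (Progress-alpha {P} {a = a} {b} _ _ _) (res p) = res (Renaming.subst-⇓⁻ b a P p)

Progress-r-nil : ∀ {L} → Progress _≡r_ (𝟎 ∖ L) 𝟎
fwd  Progress-r-nil (res _ ())
bwd  Progress-r-nil ()
endF Progress-r-nil (res ())
endB Progress-r-nil ()

Progress-r-end : ∀ {L} → Progress _≡r_ (END ∖ L) END
fwd  Progress-r-end (res _ ())
bwd  Progress-r-end ()
endF Progress-r-end _ = end
endB Progress-r-end _ = res end

Progress-r-pre : ∀ {α P L} → Allowed L α → Progress _≡r_ ((α ∙ P) ∖ L) (α ∙ (P ∖ L))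
fwd  (Progress-r-pre al) (res _ pre) = _ , pre , refl
bwd  (Progress-r-pre al) pre = _ , res al pre , refl
endF (Progress-r-pre al) (res ())
endB (Progress-r-pre al) ()

Progress-r-pre0 : ∀ {α P L} → ¬ Allowed L α → Progress _≡r_ ((α ∙ P) ∖ L) 𝟎
fwd  (Progress-r-pre0 ¬al) (res al pre) = ⊥-elim (¬al al)
bwd  (Progress-r-pre0 ¬al) ()
endF (Progress-r-pre0 ¬al) (res ())
endB (Progress-r-pre0 ¬al) ()

Progress-r-seq : ∀ {P Q L} → Progress _≡r_ ((P ⨾ Q) ∖ L) ((P ∖ L) ⨾ (Q ∖ L))
fwd  Progress-r-seq (res al (seqˡ t))   = _ , seqˡ (res al t) , r-seq
fwd  Progress-r-seq (res al (seqʳ p t)) = _ , seqʳ (res p) (res al t) , refl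
bwd  Progress-r-seq (seqˡ (res al t))         = _ , res al (seqˡ t) , r-seq
bwd  Progress-r-seq (seqʳ (res p) (res al t)) = _ , res al (seqʳ p t) , refl
endF Progress-r-seq (res (seq p q)) = seq (res p) (res q)
endB Progress-r-seq (seq (res p) (res q)) = res (seq p q)

Progress-r-sum : ∀ {P Q L} → Progress _≡r_ ((P ⊕ Q) ∖ L) ((P ∖ L) ⊕ (Q ∖ L))
fwd  Progress-r-sum (res al (sumˡ t)) = _ , sumˡ (res al t) , refl
fwd  Progress-r-sum (res al (sumʳ t)) = _ , sumʳ (res al t) , refl
bwd  Progress-r-sum (sumˡ (res al t)) = _ , res al (sumˡ t) , refl
bwd  Progress-r-sum (sumʳ (res al t)) = _ , res al (sumʳ t) , refl
endF Progress-r-sum (res (sumˡ p)) = sumˡ (res p)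
endF Progress-r-sum (res (sumʳ q)) = sumʳ (res q)
endB Progress-r-sum (sumˡ (res p)) = res (sumˡ p)
endB Progress-r-sum (sumʳ (res q)) = res (sumʳ q)

Progress-r-par : ∀ {P Q L} → Disjoint P L → Progress _≡r_ (P ∥ (Q ∖ L)) ((P ∥ Q) ∖ L)
fwd  (Progress-r-par dj) (parˡ t) =
  _ , res (Disjoint-label dj t) (parˡ t) , r-par (Disjoint-derivative dj t)
fwd  (Progress-r-par dj) (parʳ (res al u)) = _ , res al (parʳ u) , r-par dj
fwd  (Progress-r-par dj) (com c t (res _ u)) = _ , res tt (com c t u) , r-par (Disjoint-derivative dj t)
bwd  (Progress-r-par dj) (res _ (parˡ t)) = _ , parˡ t , r-par (Disjoint-derivative dj t)
bwd  (Progress-r-par dj) (res al (parʳ u)) = _ , parʳ (res al u) , r-par dj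
bwd  (Progress-r-par dj) (res _ (com c t u)) =
  _ , com c t (res (Allowed-compl c (Disjoint-label dj t)) u) , r-par (Disjoint-derivative dj t)
endF (Progress-r-par dj) (par p (res q)) = res (par p q)
endB (Progress-r-par dj) (res (par p q)) = par p (res q)

Progress-r-star : ∀ {P L} → Progress _≡r_ ((P *) ∖ L) ((P ∖ L) *)
fwd  Progress-r-star (res al (star t)) = _ , star (res al t) , trans r-seq (c-seq refl r-star)
bwd  Progress-r-star (star (res al t)) = _ , res al (star t) , trans r-seq (c-seq refl r-star)
endF Progress-r-star _ = star
endB Progress-r-star _ = res star

Progress-r-resres : ∀ {P L M} → Progress _≡r_ ((P ∖ L) ∖ M) (P ∖ (L ++ M))
fwd  (Progress-r-resres {L = L}) (res alM (res alL t)) = _ , res (Allowed-++ L alL alM) t , r-resres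
bwd  (Progress-r-resres {L = L}) (res al t) =
  _ , res (Allowed-++⁻ʳ L al) (res (Allowed-++⁻ˡ L al) t) , r-resres
endF Progress-r-resres (res (res p)) = res p
endB Progress-r-resres (res p) = res (res p)

Progress-r-drop : ∀ {P L} → Disjoint P L → Progress _≡r_ (P ∖ L) P
fwd  (Progress-r-drop dj) (res _ t) = _ , t , r-drop (Disjoint-derivative dj t)
bwd  (Progress-r-drop dj) t = _ , res (Disjoint-label dj t) t , r-drop (Disjoint-derivative dj t)
endF (Progress-r-drop dj) (res p) = p
endB (Progress-r-drop dj) p = res p

≡r-progress : ∀ {P Q} → P ≡r Q → Progress _≡r_ P Q
≡r-progress refl            = Progress-refl refl
≡r-progress (sym e)         = Progress-sym sym (≡r-progress e)
≡r-progress (trans e f)     = Progress-trans trans (≡r-progress e) (≡r-progress f)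
≡r-progress (c-pre e)       = Progress-∙ e
≡r-progress (c-seq e f)     = Progress-⨾ f (≡r-progress e) (≡r-progress f)
≡r-progress (c-sum e f)     = Progress-⊕ (≡r-progress e) (≡r-progress f)
≡r-progress (c-par e f)     = Progress-∥ e f (≡r-progress e) (≡r-progress f)
≡r-progress (c-star e)      = Progress-* e (≡r-progress e)
≡r-progress (c-res e)       = Progress-∖ (≡r-progress e)
≡r-progress (alpha a∈L b∉L b∉P) = Progress-alpha a∈L b∉L b∉P
≡r-progress r-nil           = Progress-r-nil
≡r-progress r-end           = Progress-r-end
≡r-progress (r-pre al)      = Progress-r-pre al
≡r-progress (r-pre0 ¬al)    = Progress-r-pre0 ¬al
≡r-progress r-seq           = Progress-r-seq
≡r-progress r-sum           = Progress-r-sum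
≡r-progress (r-par dj)      = Progress-r-par dj
≡r-progress r-star          = Progress-r-star
≡r-progress r-resres        = Progress-r-resres
≡r-progress (r-drop dj)     = Progress-r-drop dj

theorem5p10 : ∀ {P Q} → P ≡r Q → P ∼ Q
theorem5p10 e = _≡r_ , Progress⇒IsBisim ≡r-progress , e
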